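{- Let $k$ and $w$ be positive integers and let $(A,B)$ be a partition of the vertex set of a graph $G$ such that $G[A]$ is equipped with a labeling $f : A \to \{1,\dots,w\}$ with the property that any two vertices $x,y\in A$ with $f(x)=f(y)$ have the same set of neighbors in $B$. If $H$ is the $k$-power of $G$, then $\mathrm{mim}_H(A)\le w$.
   Context: The $k$-power of $G$ is the graph on $V(G)$ in which distinct $u,v$ are adjacent iff their distance in $G$ is at most $k$. For $X\subseteq V(H)$, $\mathrm{mim}_H(X)$ is the maximum size of an induced matching in the bipartite graph $H[X, V(H)\setminus X]$ whose parts are $X$ and $V(H)\setminus X$ and whose edges are the edges of $H$ with one endpoint in each part. -}

module Defs where

open import Data.Nat using (ℕ; zero; suc; _≤_; _+_)
open import Data.Nat.Properties using (+-comm)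
open import Data.Fin using (Fin)
open import Data.Bool using (Bool; true; false)
open import Data.Product using (Σ; _×_; _,_)
open import Relation.Binary.PropositionalEquality using (_≡_; _≢_; refl; sym; subst)
open import Relation.Nullary using (¬_)

record Graph (n : ℕ) : Set₁ where
  field
    Adj    : Fin n → Fin n → Set
    Adj-sym    : ∀ {u v} → Adj u v → Adj v u
    Adj-irrefl : ∀ {u} → ¬ Adj u u
open Graph public

data Walk {n : ℕ} (G : Graph n) : Fin n → Fin n → ℕ → Set where
  here : ∀ {u} → Walk G u u zero
  step : ∀ {u v w ℓ} → Adj G u v → Walk G v w ℓ → Walk G u w (suc ℓ)

private
  snoc : ∀ {n} {G : Graph n} {u v w ℓ} → Walk G u v ℓ → Adj G v w → Walk G u w (suc ℓ)
  snoc here e = step e here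
  snoc (step e W) e' = step e (snoc W e')

  rev : ∀ {n} {G : Graph n} {u v ℓ} → Walk G u v ℓ → Walk G v u ℓ
  rev here = here
  rev {G = G} (step e W) = snoc (rev W) (Adj-sym G e)

DistLe : ∀ {n} → Graph n → ℕ → Fin n → Fin n → Set
DistLe G k u v = Σ ℕ λ ℓ → ℓ ≤ k × Walk G u v ℓ

power : ∀ {n} → Graph n → ℕ → Graph n
power G k = record
  { Adj = λ u v → (u ≢ v) × DistLe G k u v
  ; Adj-sym = λ { (u≢v , ℓ , ℓ≤k , W) → (λ e → u≢v (sym e)) , ℓ , ℓ≤k , rev W }
  ; Adj-irrefl = λ { (u≢u , _) → u≢u refl }
  }

-- An induced matching of size m in the bipartite graph H[X, V(H) \ X],
-- where X is given by its characteristic function inX.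
record InducedMatching {n : ℕ} (H : Graph n) (inX : Fin n → Bool) (m : ℕ) : Set where
  field
    a b     : Fin m → Fin n
    a-in    : ∀ i → inX (a i) ≡ true
    b-out   : ∀ i → inX (b i) ≡ false
    a-inj   : ∀ i j → a i ≡ a j → i ≡ j
    b-inj   : ∀ i j → b i ≡ b j → i ≡ j
    edge    : ∀ i → Adj H (a i) (b i)
    induced : ∀ i j → i ≢ j → ¬ Adj H (a i) (b j)

MimLe : ∀ {n} → Graph n → (Fin n → Bool) → ℕ → Set
MimLe H inX w = ∀ m → InducedMatching H inX m → m ≤ w

module Submission where

-- Let a i — b i (i < m) be an induced matching of H = G^k across
-- the cut (A, B), with a i ∈ A and b i ∈ B.  Each matching edge is realised by
-- a walk of length ≤ k in G from a i to b i; such a walk leaves A somewhere,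
-- i.e. it traverses a G-edge x i — z i with x i ∈ A and z i ∈ B.  Label the
-- index i by f (x i).  If two distinct indices i, j had the same label, then
-- x j is also adjacent to z i (equal labels give equal neighbourhoods in B), so
-- splicing the two walks at the crossing edges gives walks a j ⇝ b i and
-- a i ⇝ b j; one of them has length ≤ k, creating a forbidden cross edge of the
-- induced matching.  Hence i ↦ f (x i) is an injection Fin m → Fin w, so m ≤ w.

open import Defs
open import Data.Nat using (ℕ; _≤_; suc; _+_; s≤s)
open import Data.Nat.Properties using (+-suc; ≤-total; +-monoʳ-≤; ≤-trans)
open import Data.Fin using (Fin)
open import Data.Fin.Properties using (injective⇒≤) renaming (_≟_ to _≟ᶠ_)
open import Data.Bool using (Bool; true; false)
open import Relation.Binary.PropositionalEquality using (_≡_; _≢_; refl; sym; trans; cong; subst)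
open import Data.Product using (_×_; _,_; proj₁; proj₂)
open import Data.Sum using (_⊎_; inj₁; inj₂)
open import Data.Empty using (⊥; ⊥-elim)
open import Relation.Nullary using (yes; no)

_++ᵂ_ : ∀ {n} {G : Graph n} {u v w p q} → Walk G u v p → Walk G v w q → Walk G u w (p + q)
here     ++ᵂ W = W
step e V   ++ᵂ W = step e (V ++ᵂ W)

inside≢outside : ∀ {n} (inX : Fin n → Bool) {u v : Fin n}
               → inX u ≡ true → inX v ≡ false → u ≢ v
inside≢outside inX hu hv refl with trans (sym hu) hv
... | ()

record Crossing {n} (G : Graph n) (inX : Fin n → Bool) (a b : Fin n) (ℓ : ℕ) : Set where
  field
    x z       : Fin n
    x-in      : inX x ≡ true
    z-out     : inX z ≡ false
    x—z       : Adj G x z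
    pre suf   : ℕ
    to-x      : Walk G a x pre
    from-z    : Walk G z b suf
    length≡   : suc (pre + suf) ≡ ℓ

-- Every walk from a vertex in X to a vertex outside X crosses the boundary
-- of X: take the first edge of the walk whose far end lies outside X.
crossing : ∀ {n} {G : Graph n} (inX : Fin n → Bool) {a b ℓ}
         → inX a ≡ true → inX b ≡ false → Walk G a b ℓ → Crossing G inX a b ℓ
crossing inX a-in b-out here = ⊥-elim (inside≢outside inX a-in b-out refl)
crossing inX {a} a-in b-out (step {v = v} e W) with inX v in v-in
... | false = record
  { x = a ; z = v ; x-in = a-in ; z-out = v-in ; x—z = e
  ; pre = 0 ; suf = _ ; to-x = here ; from-z = W ; length≡ = refl }
... | true = record
  { x = x ; z = z ; x-in = x-in ; z-out = z-out ; x—z = x—z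
  ; pre = suc pre ; suf = suf ; to-x = step e to-x ; from-z = from-z
  ; length≡ = cong suc length≡ }
  where open Crossing (crossing inX v-in b-out W)

-- If p₁ + 1 + s₁ ≤ k and p₂ + 1 + s₂ ≤ k, then one of the two spliced lengths
-- p₂ + 1 + s₁ and p₁ + 1 + s₂ is still ≤ k (swap in the shorter suffix).
spliced-length : ∀ k p₁ s₁ p₂ s₂ → suc (p₁ + s₁) ≤ k → suc (p₂ + s₂) ≤ k
               → p₂ + suc s₁ ≤ k ⊎ p₁ + suc s₂ ≤ k
spliced-length k p₁ s₁ p₂ s₂ h₁ h₂ with ≤-total s₁ s₂
... | inj₁ s₁≤s₂ = inj₁ (subst (_≤ k) (sym (+-suc p₂ s₁)) (≤-trans (s≤s (+-monoʳ-≤ p₂ s₁≤s₂)) h₂))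
... | inj₂ s₂≤s₁ = inj₂ (subst (_≤ k) (sym (+-suc p₁ s₂)) (≤-trans (s≤s (+-monoʳ-≤ p₁ s₂≤s₁)) h₁))

splice : ∀ {n} {G : Graph n} {inX : Fin n → Bool} {a₁ b₁ a₂ b₂ ℓ₁ ℓ₂}
       → (c₁ : Crossing G inX a₁ b₁ ℓ₁) (c₂ : Crossing G inX a₂ b₂ ℓ₂)
       → Adj G (Crossing.x c₂) (Crossing.z c₁)
       → Walk G a₂ b₁ (Crossing.pre c₂ + suc (Crossing.suf c₁))
splice c₁ c₂ x₂—z₁ = Crossing.to-x c₂ ++ᵂ step x₂—z₁ (Crossing.from-z c₁)

module CrossingLabels {n k w : ℕ} (G : Graph n) (inA : Fin n → Bool)
  (f : (x : Fin n) → inA x ≡ true → Fin w)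
  (same-label⇒same-nbrs : ∀ x y (hx : inA x ≡ true) (hy : inA y ≡ true) → f x hx ≡ f y hy
    → ∀ z → inA z ≡ false → (Adj G x z → Adj G y z) × (Adj G y z → Adj G x z))
  {m : ℕ} (M : InducedMatching (power G k) inA m) where

  open InducedMatching M

  walk-length : Fin m → ℕ
  walk-length i = proj₁ (proj₂ (edge i))

  walk-length≤k : ∀ i → walk-length i ≤ k
  walk-length≤k i = proj₁ (proj₂ (proj₂ (edge i)))

  exit : ∀ i → Crossing G inA (a i) (b i) (walk-length i)
  exit i = crossing inA (a-in i) (b-out i) (proj₂ (proj₂ (proj₂ (edge i))))

  open Crossing

  exit-length≤k : ∀ i → suc (pre (exit i) + suf (exit i)) ≤ k
  exit-length≤k i = subst (_≤ k) (sym (length≡ (exit i))) (walk-length≤k i)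

  label : Fin m → Fin w
  label i = f (x (exit i)) (x-in (exit i))

  -- For i ≠ j with equal labels, the spliced walk a j ⇝ x j — z i ⇝ b i cannot
  -- have length ≤ k: otherwise a j — b i would be an edge of G^k across the cut,
  -- violating inducedness.
  spliced-too-long : ∀ {i j} → i ≢ j → label i ≡ label j
                   → pre (exit j) + suc (suf (exit i)) ≤ k → ⊥
  spliced-too-long {i} {j} i≢j same short =
    induced j i (λ j≡i → i≢j (sym j≡i))
      (inside≢outside inA (a-in j) (b-out i) , _ , short , splice (exit i) (exit j) xj—zi)
    where
      xj—zi : Adj G (x (exit j)) (z (exit i))
      xj—zi = proj₁ (same-label⇒same-nbrs _ _ (x-in (exit i)) (x-in (exit j)) same
                      (z (exit i)) (z-out (exit i))) (x—z (exit i))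

  label-injective : ∀ {i j} → label i ≡ label j → i ≡ j
  label-injective {i} {j} same with i ≟ᶠ j
  ... | yes i≡j = i≡j
  ... | no i≢j with spliced-length k (pre (exit i)) (suf (exit i)) (pre (exit j)) (suf (exit j))
                      (exit-length≤k i) (exit-length≤k j)
  ... | inj₁ short = ⊥-elim (spliced-too-long i≢j same short)
  ... | inj₂ short = ⊥-elim (spliced-too-long (λ j≡i → i≢j (sym j≡i)) (sym same) short)

lemma3 : (n k w : ℕ) → 1 ≤ k → 1 ≤ w → (G : Graph n) → (inA : Fin n → Bool)
    → (f : (x : Fin n) → inA x ≡ true → Fin w)
    → (∀ x y (hx : inA x ≡ true) (hy : inA y ≡ true) → f x hx ≡ f y hy
    → ∀ z → inA z ≡ false → (Adj G x z → Adj G y z) × (Adj G y z → Adj G x z))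
    → MimLe (power G k) inA w
lemma3 n k w _ _ G inA f same-label⇒same-nbrs m M = injective⇒≤ label-injective
  where open CrossingLabels {k = k} G inA f same-label⇒same-nbrs M
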